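{- Let $D$ be a Hamiltonian digraph and let $C$ be a Hamiltonian cycle of $D$. If for every $v\in V(D)$ there is an even chord of $C$ with tail $v$, then $D$ has a strong $2$-partition.
   Context: All digraphs are finite, loopless, without parallel arcs (opposite arcs are allowed). For a cycle $C=x_0x_1\dots x_{n-1}x_0$ (indices mod $n$), a chord of $C$ is an arc $x_px_q$ of $D$ with $x_q\ne x_{p+1}$ (and $x_q\ne x_p$); its length is the length of the directed subpath $x_px_{p+1}\dots x_q$ of $C$, and the chord is even if this length is even. A 2-partition of $D$ is a partition $(V_1,V_2)$ of $V(D)$ into two parts; $B_D(V_1,V_2)$ is the spanning subdigraph of $D$ whose arcs are the arcs of $D$ with one end in $V_1$ and the other in $V_2$. The 2-partition is strong if $B_D(V_1,V_2)$ is strongly connected (for every ordered pair $(u,v)$ of vertices there is a directed $uv$-path in it). -}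

module Defs where

open import Data.Nat using (ℕ; zero; suc; _+_; _∸_; _%_; _≥_; NonZero)
open import Data.Nat.DivMod using (m%n<n)
open import Data.Nat.Divisibility using (_∣_)
open import Data.Fin using (Fin; toℕ; fromℕ<)
open import Data.Bool using (Bool; true; false; _≟_)
open import Data.Product using (Σ; ∃; _×_; _,_)
open import Relation.Nullary using (¬_)
open import Relation.Binary.PropositionalEquality using (_≡_; _≢_)
open import Relation.Binary.Construct.Closure.ReflexiveTransitive using (Star)
open import Function.Bundles using (_↔_)
import Function.Bundles

-- A digraph on vertex set Fin n: an arc relation that is loopless.
-- (A relation automatically has no parallel arcs; opposite arcs allowed.)
record Digraph (n : ℕ) : Set₁ where
  field
    Arc      : Fin n → Fin n → Set
    loopless : ∀ x → ¬ Arc x x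
open Digraph public

nextPos : ∀ {n} .{{_ : NonZero n}} → Fin n → Fin n
nextPos {n} i = fromℕ< (m%n<n (suc (toℕ i)) n)

pathLength : ∀ {n} .{{_ : NonZero n}} → Fin n → Fin n → ℕ
pathLength {n} p q = ((toℕ q + n) ∸ toℕ p) % n

-- A Hamiltonian cycle of D: a bijection x : positions → vertices
-- (so x_0 x_1 … x_{n-1} lists every vertex exactly once), with arcs
-- x_i x_{i+1} (indices mod n), and n ≥ 2 (D is loopless).
record HamiltonianCycle {n} .{{_ : NonZero n}} (D : Digraph n) : Set₁ where
  field
    atLeastTwo : n ≥ 2
    x          : Fin n ↔ Fin n
    cycleArc   : ∀ i → Arc D (Function.Bundles.Inverse.to x i)
                                 (Function.Bundles.Inverse.to x (nextPos i))

Hamiltonian : ∀ {n} .{{_ : NonZero n}} → Digraph n → Set₁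
Hamiltonian D = HamiltonianCycle D

module _ {n} .{{_ : NonZero n}} {D : Digraph n} (C : HamiltonianCycle D) where
  open HamiltonianCycle C using () renaming (x to xC)
  private
    vx : Fin n → Fin n
    vx = Function.Bundles.Inverse.to xC

  IsChord : Fin n → Fin n → Set
  IsChord p q = Arc D (vx p) (vx q) × vx q ≢ vx (nextPos p) × vx q ≢ vx p

  EvenChordWithTail : Fin n → Set
  EvenChordWithTail v =
    Σ (Fin n) λ p → Σ (Fin n) λ q →
      vx p ≡ v × IsChord p q × 2 ∣ pathLength p q

BArc : ∀ {n} → Digraph n → (Fin n → Bool) → Fin n → Fin n → Set
BArc D P u v = Arc D u v × P u ≢ P v

StronglyConnected : ∀ {n} → (Fin n → Fin n → Set) → Set
StronglyConnected {n} R = ∀ (u v : Fin n) → Star R u v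

IsTwoPartition : ∀ {n} → (Fin n → Bool) → Set
IsTwoPartition {n} P = (Σ (Fin n) λ u → P u ≡ true) × (Σ (Fin n) λ v → P v ≡ false)

HasStrong2Partition : ∀ {n} → Digraph n → Set
HasStrong2Partition {n} D =
  Σ (Fin n → Bool) λ P → IsTwoPartition P × StronglyConnected (BArc D P)

-- If n is even, colour each vertex of the Hamiltonian cycle by the parity of its
-- position: every cycle arc then joins the two classes, so the cycle itself is strong
-- in B(V₁,V₂). If n is odd, number the cycle from the tail of a shortest even chord,
-- of length L, and flip the colours of the positions L, …, n-1. The cycle arcs still
-- cross except for (L-1, L), whose role is taken over by the chord (0, L). Every
-- position ≥ L walks forward to n-1 and crosses to 0. A position k < L uses its own
-- even chord, of length at least L: it either lands at a position ≥ L of opposite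
-- colour, or wraps around the odd cycle to a position smaller than k whose colour is
-- again opposite, and induction on k finishes.
module Submission where

open import Data.Bool using (Bool; true; false)
open import Data.Empty using (⊥-elim)
open import Data.Fin using (Fin; toℕ; fromℕ<) renaming (zero to fzero)
open import Data.Fin.Properties using (toℕ-fromℕ<; toℕ-injective; toℕ<n)
open import Data.List using (allFin)
open import Data.List.Extrema.Nat using (argmin; f[argmin]≤f[xs])
open import Data.List.Membership.Propositional.Properties using (∈-allFin)
open import Data.List.Relation.Unary.All using (lookup)
open import Data.Nat
open import Data.Nat.DivMod
open import Data.Nat.Divisibility using (_∣_; divides)
open import Data.Nat.Induction using (<-rec)
open import Data.Nat.Properties
open import Data.Parity.Base using (Parity; 0ℙ; 1ℙ; _⁻¹) renaming (_+_ to _⊕_)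
import Data.Parity.Properties as ℙ
open import Data.Product using (Σ; _×_; _,_; proj₁; uncurry)
open import Data.Sum using (inj₁; inj₂)
open import Function using (_∘_)
open import Function.Bundles using (Inverse; Injection)
open import Function.Properties.Inverse using (↔⇒↣)
open import Relation.Binary.Construct.Closure.ReflexiveTransitive using (Star; ε; _◅_; _◅◅_; gmap)
open import Relation.Binary.PropositionalEquality
open import Relation.Nullary using (yes; no)

open import Defs

parity-suc : ∀ m → parity (suc m) ≡ parity m ⁻¹
parity-suc m = ℙ.+-homo-+ 1 m

parity-+-even : ∀ k {d} → parity d ≡ 0ℙ → parity (k + d) ≡ parity k
parity-+-even k {d} d-even =
  trans (ℙ.+-homo-+ k d) (trans (cong (parity k ⊕_) d-even) (ℙ.+-identityʳ (parity k)))

parity-+-odd : ∀ k {d} → parity d ≡ 1ℙ → parity (k + d) ≡ parity k ⁻¹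
parity-+-odd k {d} d-odd =
  trans (ℙ.+-homo-+ k d) (trans (cong (parity k ⊕_) d-odd) (ℙ.+-comm (parity k) 1ℙ))

2∣⇒parity≡0ℙ : ∀ {d} → 2 ∣ d → parity d ≡ 0ℙ
2∣⇒parity≡0ℙ (divides k refl) = trans (ℙ.*-homo-* k 2) (ℙ.*-zeroʳ (parity k))

≡⁻¹⇒≢ : ∀ {p q} → q ≡ p ⁻¹ → p ≢ q
≡⁻¹⇒≢ {p} q≡p⁻¹ p≡q = ℙ.p≢p⁻¹ p (trans p≡q q≡p⁻¹)

isOdd : Parity → Bool
isOdd 0ℙ = false
isOdd 1ℙ = true

isOdd-injective : ∀ {p q} → isOdd p ≡ isOdd q → p ≡ q
isOdd-injective {0ℙ} {0ℙ} _ = refl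
isOdd-injective {1ℙ} {1ℙ} _ = refl

-- Cycle positions are natural numbers read modulo n = suc n'.
module CycleCrossing (n' : ℕ) (A : ℕ → ℕ → Set)
  (along : ∀ i → A i (suc i)) (wrap : ∀ {i} j → A i (j + suc n') → A i j) where

  n : ℕ
  n = suc n'

  Cross : (ℕ → Parity) → ℕ → ℕ → Set
  Cross col i j = i < n × j < n × A i j × col i ≢ col j

  Strong : (ℕ → Parity) → Set
  Strong col = ∀ {i j} → i < n → j < n → Star (Cross col) i j

  Alternating : (ℕ → Parity) → ℕ → ℕ → Set
  Alternating col i j = ∀ {m} → i ≤ m → m < j → col m ≢ col (suc m)

  module _ {col : ℕ → Parity} where

    cross : ∀ {i j} → i < n → j < n → A i j → col i ≢ col j → Star (Cross col) i j
    cross i<n j<n a i≢j = (i<n , j<n , a , i≢j) ◅ ε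

    walk : ∀ {i} j → i ≤ j → j < n → Alternating col i j → Star (Cross col) i j
    walk j i≤j j<n alt with m≤n⇒m<n∨m≡n i≤j
    walk j _ _ _ | inj₂ refl = ε
    walk (suc j) _ j<n alt | inj₁ (s≤s i≤j) =
      walk j i≤j (<-trans (n<1+n j) j<n) (λ i≤m m<j → alt i≤m (m<n⇒m<1+n m<j))
      ◅◅ cross (<-trans (n<1+n j) j<n) j<n (along j) (alt i≤j ≤-refl)

    to-origin : ∀ {i j} → Alternating col i n' → col n' ≢ col 0 →
                i ≤ j → j < n → Star (Cross col) j 0
    to-origin alt closes i≤j (s≤s j≤n') =
      walk n' j≤n' ≤-refl (λ j≤m → alt (≤-trans i≤j j≤m))
      ◅◅ cross ≤-refl z<s (wrap 0 (along n')) closes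

    via-origin : (∀ {j} → j < n → Star (Cross col) j 0) →
                 (∀ {j} → j < n → Star (Cross col) 0 j) → Strong col
    via-origin to from i<n j<n = to i<n ◅◅ from j<n

  parity-alternating : ∀ {i j} → Alternating parity i j
  parity-alternating {m = m} _ _ = ≡⁻¹⇒≢ (parity-suc m)

  parity-strong : parity n ≡ 0ℙ → Strong parity
  parity-strong n-even = via-origin
    (to-origin parity-alternating closes z≤n)
    (λ j<n → walk _ z≤n j<n parity-alternating)
    where
    closes : parity n' ≢ 0ℙ
    closes = ≡⁻¹⇒≢ (trans (sym n-even) (parity-suc n'))

  record EvenChord (i : ℕ) : Set where
    field
      len      : ℕ
      len>0    : 0 < len
      len<n    : len < n
      len-even : parity len ≡ 0ℙ
      arc      : A i (i + len)

  open EvenChord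

  module ShortestChord (n-odd : parity n ≡ 1ℙ) (chord : ∀ i → EvenChord i)
    (shortest : ∀ i → len (chord 0) ≤ len (chord i)) where

    L : ℕ
    L = len (chord 0)

    colour : ℕ → Parity
    colour j with j <? L
    ... | yes _ = parity j
    ... | no  _ = parity j ⁻¹

    colour-below : ∀ {j} → j < L → colour j ≡ parity j
    colour-below {j} j<L with j <? L
    ... | yes _   = refl
    ... | no  j≮L = ⊥-elim (j≮L j<L)

    colour-above : ∀ {j} → L ≤ j → colour j ≡ parity j ⁻¹
    colour-above {j} L≤j with j <? L
    ... | yes j<L = ⊥-elim (<⇒≱ j<L L≤j)
    ... | no  _   = refl

    alternating-below : ∀ {j} → j < L → Alternating colour 0 j
    alternating-below j<L {m} _ m<j = subst₂ _≢_
      (sym (colour-below (<-trans m<j j<L))) (sym (colour-below (≤-<-trans m<j j<L)))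
      (≡⁻¹⇒≢ (parity-suc m))

    alternating-above : ∀ {j} → Alternating colour L j
    alternating-above {m = m} L≤m _ = subst₂ _≢_
      (sym (colour-above L≤m)) (sym (colour-above (m≤n⇒m≤1+n L≤m)))
      (≡⁻¹⇒≢ (cong _⁻¹ (parity-suc m)))

    L>0 : 0 < L
    L>0 = len>0 (chord 0)

    colour-0≢L : colour 0 ≢ colour L
    colour-0≢L = subst₂ _≢_ (sym (colour-below L>0))
      (sym (trans (colour-above ≤-refl) (cong _⁻¹ (len-even (chord 0))))) λ ()

    colour-n'≢0 : colour n' ≢ colour 0
    colour-n'≢0 = subst₂ _≢_
      (sym (trans (colour-above (s≤s⁻¹ (len<n (chord 0)))) (trans (sym (parity-suc n')) n-odd)))
      (sym (colour-below L>0)) λ ()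

    above-to-origin : ∀ {j} → L ≤ j → j < n → Star (Cross colour) j 0
    above-to-origin = to-origin alternating-above colour-n'≢0

    below-to-origin : ∀ j → j < L → Star (Cross colour) j 0
    below-to-origin = <-rec (λ j → j < L → Star (Cross colour) j 0) step
      where
      step : ∀ k → (∀ {t} → t < k → t < L → Star (Cross colour) t 0) →
             k < L → Star (Cross colour) k 0
      step k ih k<L with k + len (chord k) <? n
      ... | yes k+d<n = cross k<n k+d<n (arc (chord k)) forward-crosses
                        ◅◅ above-to-origin L≤k+d k+d<n
        where
        k<n = <-trans k<L (len<n (chord 0))
        L≤k+d = ≤-trans (shortest k) (m≤n+m _ k)
        forward-crosses : colour k ≢ colour (k + len (chord k))
        forward-crosses = subst₂ _≢_ (sym (colour-below k<L))
          (sym (trans (colour-above L≤k+d) (cong _⁻¹ (parity-+-even k (len-even (chord k))))))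
          (≡⁻¹⇒≢ refl)
      ... | no k+d≮n = cross k<n (<-trans t<k k<n) (wrap t arc-t) wrapped-crosses
                       ◅◅ ih t<k (<-trans t<k k<L)
        where
        d = len (chord k)
        k<n = <-trans k<L (len<n (chord 0))
        n≤k+d = ≮⇒≥ k+d≮n
        t = k + d ∸ n
        k+d≡t+n : k + d ≡ t + n
        k+d≡t+n = sym (m∸n+n≡m n≤k+d)
        t<k : t < k
        t<k = +-cancelʳ-< n t k (subst (_< k + n) k+d≡t+n (+-monoʳ-< k (len<n (chord k))))
        arc-t : A k (t + n)
        arc-t = subst (A k) k+d≡t+n (arc (chord k))
        wrapped-crosses : colour k ≢ colour t
        wrapped-crosses = subst₂ _≢_ (sym (colour-below k<L)) (sym (colour-below (<-trans t<k k<L)))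
          (≢-sym (≡⁻¹⇒≢ (begin
            parity k            ≡⟨ parity-+-even k (len-even (chord k)) ⟨
            parity (k + d)      ≡⟨ cong parity k+d≡t+n ⟩
            parity (t + n)      ≡⟨ parity-+-odd t n-odd ⟩
            parity t ⁻¹         ∎)))
          where open ≡-Reasoning

    strong : Strong colour
    strong = via-origin to from
      where
      to : ∀ {j} → j < n → Star (Cross colour) j 0
      to {j} j<n with j <? L
      ... | yes j<L = below-to-origin j j<L
      ... | no  j≮L = above-to-origin (≮⇒≥ j≮L) j<n
      from : ∀ {j} → j < n → Star (Cross colour) 0 j
      from {j} j<n with j <? L
      ... | yes j<L = walk j z≤n j<n (alternating-below j<L)
      ... | no  j≮L = cross z<s (len<n (chord 0)) (arc (chord 0)) colour-0≢L
                      ◅◅ walk j (≮⇒≥ j≮L) j<n alternating-above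

  strong-colouring : (chord : ∀ i → EvenChord i) → (∀ i → len (chord 0) ≤ len (chord i)) →
                     Σ (ℕ → Parity) Strong
  strong-colouring chord shortest with parity n in n-parity
  ... | 0ℙ = parity , parity-strong n-parity
  ... | 1ℙ = colour , strong
    where open ShortestChord n-parity chord shortest

module _ {n : ℕ} .{{_ : NonZero n}} where

  %-absorbˡ : ∀ m k → (m % n + k) % n ≡ (m + k) % n
  %-absorbˡ m k = begin
    (m % n + k) % n            ≡⟨ %-distribˡ-+ (m % n) k n ⟩
    (m % n % n + k % n) % n    ≡⟨ cong (λ z → (z + k % n) % n) (m%n%n≡m%n m n) ⟩
    (m % n + k % n) % n        ≡⟨ %-distribˡ-+ m k n ⟨
    (m + k) % n                ∎
    where open ≡-Reasoning

  +-%-cancelˡ : ∀ {b i j} → b ≤ n → i < n → j < n → (b + i) % n ≡ (b + j) % n → i ≡ j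
  +-%-cancelˡ {b} {i} {j} b≤n i<n j<n eq =
    trans (sym (undo i<n)) (trans (cong (λ z → (z + (n ∸ b)) % n) eq) (undo j<n))
    where
    undo : ∀ {k} → k < n → ((b + k) % n + (n ∸ b)) % n ≡ k
    undo {k} k<n = begin
      ((b + k) % n + (n ∸ b)) % n  ≡⟨ %-absorbˡ (b + k) (n ∸ b) ⟩
      (b + k + (n ∸ b)) % n        ≡⟨ cong (_% n) (+-comm (b + k) (n ∸ b)) ⟩
      (n ∸ b + (b + k)) % n        ≡⟨ cong (_% n) (+-assoc (n ∸ b) b k) ⟨
      (n ∸ b + b + k) % n          ≡⟨ cong (λ z → (z + k) % n) (m∸n+n≡m b≤n) ⟩
      (n + k) % n                  ≡⟨ cong (_% n) (+-comm n k) ⟩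
      (k + n) % n                  ≡⟨ [m+n]%n≡m%n k n ⟩
      k % n                        ≡⟨ m<n⇒m%n≡m k<n ⟩
      k                            ∎
      where open ≡-Reasoning

  pathLength<n : ∀ (a q : Fin n) → pathLength a q < n
  pathLength<n a q = m%n<n (toℕ q + n ∸ toℕ a) n

  +-pathLength : ∀ (a q : Fin n) → (toℕ a + pathLength a q) % n ≡ toℕ q
  +-pathLength a q = begin
    (toℕ a + (toℕ q + n ∸ toℕ a) % n) % n  ≡⟨ cong (_% n) (+-comm (toℕ a) _) ⟩
    ((toℕ q + n ∸ toℕ a) % n + toℕ a) % n  ≡⟨ %-absorbˡ (toℕ q + n ∸ toℕ a) (toℕ a) ⟩
    (toℕ q + n ∸ toℕ a + toℕ a) % n        ≡⟨ cong (_% n) (m∸n+n≡m a≤q+n) ⟩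
    (toℕ q + n) % n                        ≡⟨ [m+n]%n≡m%n (toℕ q) n ⟩
    toℕ q % n                              ≡⟨ m<n⇒m%n≡m (toℕ<n q) ⟩
    toℕ q                                  ∎
    where
    open ≡-Reasoning
    a≤q+n : toℕ a ≤ toℕ q + n
    a≤q+n = ≤-trans (<⇒≤ (toℕ<n a)) (m≤n+m n (toℕ q))

module Rotation {n : ℕ} .{{_ : NonZero n}} (b : Fin n) where

  pos : ℕ → Fin n
  pos i = fromℕ< (m%n<n (toℕ b + i) n)

  offset : Fin n → ℕ
  offset = pathLength b

  toℕ-pos : ∀ i → toℕ (pos i) ≡ (toℕ b + i) % n
  toℕ-pos i = toℕ-fromℕ< (m%n<n (toℕ b + i) n)

  toℕ-pos-+ : ∀ i d → toℕ (pos (i + d)) ≡ (toℕ (pos i) + d) % n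
  toℕ-pos-+ i d = begin
    toℕ (pos (i + d))          ≡⟨ toℕ-pos (i + d) ⟩
    (toℕ b + (i + d)) % n      ≡⟨ cong (_% n) (+-assoc (toℕ b) i d) ⟨
    (toℕ b + i + d) % n        ≡⟨ %-absorbˡ (toℕ b + i) d ⟨
    ((toℕ b + i) % n + d) % n  ≡⟨ cong (λ z → (z + d) % n) (toℕ-pos i) ⟨
    (toℕ (pos i) + d) % n      ∎
    where open ≡-Reasoning

  pos-0 : pos 0 ≡ b
  pos-0 = toℕ-injective (trans (toℕ-pos 0)
    (trans (cong (_% n) (+-identityʳ (toℕ b))) (m<n⇒m%n≡m (toℕ<n b))))

  pos-suc : ∀ i → nextPos (pos i) ≡ pos (suc i)
  pos-suc i = trans
    (toℕ-injective (trans (toℕ-fromℕ< (m%n<n (suc (toℕ (pos i))) n))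
      (trans (cong (_% n) (+-comm 1 (toℕ (pos i)))) (sym (toℕ-pos-+ i 1)))))
    (cong pos (+-comm i 1))

  pos-+n : ∀ i → pos (i + n) ≡ pos i
  pos-+n i = toℕ-injective (trans (toℕ-pos-+ i n)
    (trans ([m+n]%n≡m%n (toℕ (pos i)) n) (m<n⇒m%n≡m (toℕ<n (pos i)))))

  pos-pathLength : ∀ i q → pos (i + pathLength (pos i) q) ≡ q
  pos-pathLength i q = toℕ-injective (trans (toℕ-pos-+ i _) (+-pathLength (pos i) q))

  pos-offset : ∀ q → pos (offset q) ≡ q
  pos-offset q = subst (λ a → pos (pathLength a q) ≡ q) pos-0 (pos-pathLength 0 q)

  offset<n : ∀ q → offset q < n
  offset<n = pathLength<n b

  pos-injective : ∀ {i j} → i < n → j < n → pos i ≡ pos j → i ≡ j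
  pos-injective {i} {j} i<n j<n eq = +-%-cancelˡ (<⇒≤ (toℕ<n b)) i<n j<n
    (trans (sym (toℕ-pos i)) (trans (cong toℕ eq) (toℕ-pos j)))

  offset-pos : ∀ {i} → i < n → offset (pos i) ≡ i
  offset-pos {i} i<n = pos-injective (offset<n (pos i)) i<n (pos-offset (pos i))

≢⇒two-partition : ∀ {n} {P : Fin n → Bool} {u v} → P u ≢ P v → IsTwoPartition P
≢⇒two-partition {P = P} {u} {v} Pu≢Pv with P u in Pu | P v in Pv
... | true  | false = (u , Pu) , (v , Pv)
... | false | true  = (v , Pv) , (u , Pu)
... | true  | true  = ⊥-elim (Pu≢Pv refl)
... | false | false = ⊥-elim (Pu≢Pv refl)

strong⇒two-partition : ∀ {n} (D : Digraph n) {P u v} → Arc D u v →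
                       StronglyConnected (BArc D P) → IsTwoPartition P
strong⇒two-partition D {u = u} {v} uv strong with strong u v
... | ε               = ⊥-elim (loopless D u uv)
... | (_ , Pu≢Pw) ◅ _ = ≢⇒two-partition Pu≢Pw

module _ {n' : ℕ} (D : Digraph (suc n')) (C : HamiltonianCycle D)
  (even-chords : ∀ v → EvenChordWithTail C v) where

  open HamiltonianCycle C

  vertex : Fin (suc n') → Fin (suc n')
  vertex = Inverse.to x

  position : Fin (suc n') → Fin (suc n')
  position = Inverse.from x

  ChordAt : Fin (suc n') → Set
  ChordAt k = Σ (Fin (suc n')) λ q →
    Arc D (vertex k) (vertex q) × vertex q ≢ vertex k × 2 ∣ pathLength k q

  -- The condition x_q ≠ x_{p+1} is dropped: evenness and q ≠ p already force length ≥ 2.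
  chordAt : ∀ k → ChordAt k
  chordAt k with even-chords (vertex k)
  ... | p , q , p↦k , (pq , _ , q≢p) , even =
    subst ChordAt (Injection.injective (↔⇒↣ x) p↦k) (q , pq , q≢p , even)

  chordLength : Fin (suc n') → ℕ
  chordLength k = pathLength k (proj₁ (chordAt k))

  start : Fin (suc n')
  start = argmin chordLength fzero (allFin (suc n'))

  start-shortest : ∀ k → chordLength start ≤ chordLength k
  start-shortest k = lookup (f[argmin]≤f[xs] {f = chordLength} fzero (allFin (suc n'))) (∈-allFin k)

  open Rotation start

  at : ℕ → Fin (suc n')
  at i = vertex (pos i)

  CycleArc : ℕ → ℕ → Set
  CycleArc i j = Arc D (at i) (at j)

  along : ∀ i → CycleArc i (suc i)
  along i = subst (Arc D (at i) ∘ vertex) (pos-suc i) (cycleArc (pos i))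

  wrap : ∀ {i} j → CycleArc i (j + suc n') → CycleArc i j
  wrap {i} j = subst (Arc D (at i) ∘ vertex) (pos-+n j)

  open CycleCrossing n' CycleArc along wrap

  toEvenChord : ∀ i → ChordAt (pos i) → EvenChord i
  toEvenChord i (q , pq , q≢p , even) = record
    { len      = d
    ; len>0    = n≢0⇒n>0 d≢0
    ; len<n    = pathLength<n (pos i) q
    ; len-even = 2∣⇒parity≡0ℙ even
    ; arc      = subst (Arc D (at i) ∘ vertex) (sym (pos-pathLength i q)) pq
    }
    where
    d = pathLength (pos i) q
    d≢0 : d ≢ 0
    d≢0 d≡0 = q≢p (cong vertex (begin
      q                ≡⟨ pos-pathLength i q ⟨
      pos (i + d)      ≡⟨ cong (λ e → pos (i + e)) d≡0 ⟩
      pos (i + 0)      ≡⟨ cong pos (+-identityʳ i) ⟩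
      pos i            ∎))
      where open ≡-Reasoning

  chord : ∀ i → EvenChord i
  chord i = toEvenChord i (chordAt (pos i))

  shortest : ∀ i → EvenChord.len (chord 0) ≤ EvenChord.len (chord i)
  shortest i = subst (λ s → chordLength s ≤ chordLength (pos i)) (sym pos-0) (start-shortest (pos i))

  colouring⇒strong-2-partition : ∀ colour → Strong colour → HasStrong2Partition D
  colouring⇒strong-2-partition colour strong =
    P , strong⇒two-partition D (cycleArc fzero) strong-P , strong-P
    where
    P : Fin (suc n') → Bool
    P v = isOdd (colour (offset (position v)))
    P-at : ∀ {i} → i < suc n' → P (at i) ≡ isOdd (colour i)
    P-at {i} i<n = cong (isOdd ∘ colour)
      (trans (cong offset (Inverse.strictlyInverseʳ x (pos i))) (offset-pos i<n))
    cross⇒BArc : ∀ {i j} → Cross colour i j → BArc D P (at i) (at j)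
    cross⇒BArc (i<n , j<n , ij , i≢j) =
      ij , λ e → i≢j (isOdd-injective (trans (sym (P-at i<n)) (trans e (P-at j<n))))
    at-offset : ∀ v → at (offset (position v)) ≡ v
    at-offset v = trans (cong vertex (pos-offset (position v))) (Inverse.strictlyInverseˡ x v)
    strong-P : StronglyConnected (BArc D P)
    strong-P u v = subst₂ (Star (BArc D P)) (at-offset u) (at-offset v)
      (gmap at cross⇒BArc (strong (offset<n (position u)) (offset<n (position v))))

  strong-2-partition : HasStrong2Partition D
  strong-2-partition = uncurry colouring⇒strong-2-partition (strong-colouring chord shortest)

theorem8 : ∀ (n : ℕ) .{{_ : NonZero n}} (D : Digraph n) (C : HamiltonianCycle D) →
    (∀ (v : Fin n) → EvenChordWithTail C v) →
    HasStrong2Partition D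
theorem8 zero D C _ with HamiltonianCycle.atLeastTwo C
... | ()
theorem8 (suc n') D C even-chords = strong-2-partition D C even-chords
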